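{- Let $T$ be a lobster, $P$ a longest path of $T$, and let $S$ be the shell of $T$ (with respect to $P$), of order $n$. If $n$ is even then $S$ has a perfect matching; if $n$ is odd then $S$ has a matching covering $n-1$ vertices.
   Context: A lobster is a tree in which every vertex is at distance at most $2$ from a longest path. For a lobster $T$ with longest path $P$, the shell of $T$ is the tree obtained from $T$ by deleting every leaf not on $P$ that is adjacent to a vertex of $P$, and, for each vertex at distance one from $P$, deleting all but one of its leaf neighbours not on $P$. (Thus the shell consists of $P$ together with pendant paths of length two attached to vertices of $P$.) -}

module Defs where

open import Level using (0ℓ)
open import Data.Nat using (ℕ; _≤_; _*_; _∸_; _%_)
open import Data.Fin using (Fin)
open import Data.Fin.Subset using (Subset; _∈_; _∉_; ∣_∣)
open import Data.List using (List; []; _∷_; length; concatMap)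
open import Data.List.Membership.Propositional using () renaming (_∈_ to _∈ₗ_; _∉_ to _∉ₗ_)
open import Data.List.Relation.Unary.All using (All)
open import Data.List.Relation.Unary.Linked using (Linked)
open import Data.List.Relation.Unary.Unique.Propositional using (Unique)
open import Data.Product using (Σ; ∃; _×_; _,_)
open import Data.Sum using (_⊎_)
open import Relation.Nullary using (¬_)
open import Relation.Binary.PropositionalEquality using (_≡_)

record Graph (n : ℕ) : Set₁ where
  field
    Adj    : Fin n → Fin n → Set
    sym    : ∀ {u v} → Adj u v → Adj v u
    irrefl : ∀ {u} → ¬ Adj u u

module _ {n : ℕ} (G : Graph n) where
  open Graph G

  data Reach : Fin n → Fin n → Set where
    here : ∀ {u} → Reach u u
    step : ∀ {u v w} → Adj u v → Reach v w → Reach u w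

  Connected : Set
  Connected = ∀ u v → Reach u v

  lastOf : Fin n → List (Fin n) → Fin n
  lastOf x []       = x
  lastOf _ (y ∷ ys) = lastOf y ys

  IsPath : List (Fin n) → Set
  IsPath xs = Unique xs × Linked Adj xs × ¬ (xs ≡ [])

  HasCycle : Set
  HasCycle = Σ (Fin n) λ u → Σ (Fin n) λ v → Σ (Fin n) λ w → Σ (List (Fin n)) λ xs →
    Unique (u ∷ v ∷ w ∷ xs) × Linked Adj (u ∷ v ∷ w ∷ xs) × Adj (lastOf w xs) u

  IsTree : Set
  IsTree = Connected × ¬ HasCycle

  IsLongestPath : List (Fin n) → Set
  IsLongestPath P = IsPath P × (∀ Q → IsPath Q → length Q ≤ length P)

  Leaf : Fin n → Set
  Leaf v = Σ (Fin n) λ u → Adj v u × (∀ w → Adj v w → w ≡ u)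

  module _ (P : List (Fin n)) where
    AdjToPath : Fin n → Set
    AdjToPath v = Σ (Fin n) λ p → p ∈ₗ P × Adj p v

    Dist1 : Fin n → Set
    Dist1 v = v ∉ₗ P × AdjToPath v

    Within2 : Fin n → Set
    Within2 v = v ∈ₗ P ⊎ AdjToPath v ⊎ (Σ (Fin n) λ w → AdjToPath w × Adj w v)

    LeafNbrOffP : Fin n → Fin n → Set
    LeafNbrOffP v u = Adj v u × Leaf u × u ∉ₗ P

    -- W is the vertex set of a shell of the tree w.r.t. P (the choice of the
    -- single leaf kept at each distance-one vertex is arbitrary; the shell is
    -- the subgraph induced by W).
    IsShell : Subset n → Set
    IsShell W =
        (∀ v → v ∈ₗ P → v ∈ W)
      × (∀ v → Dist1 v → Leaf v → v ∉ W)
      × (∀ v → Dist1 v → ¬ Leaf v → v ∈ W)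
      × (∀ v → Dist1 v → (Σ (Fin n) λ u → LeafNbrOffP v u) →
           Σ (Fin n) λ u → LeafNbrOffP v u × u ∈ W ×
             (∀ u' → LeafNbrOffP v u' → u' ∈ W → u' ≡ u))
      × (∀ w → w ∈ W →
           w ∈ₗ P ⊎ Dist1 w ⊎ (Σ (Fin n) λ v → Dist1 v × LeafNbrOffP v w))

  IsMatchingIn : Subset n → List (Fin n × Fin n) → Set
  IsMatchingIn W M =
      All (λ { (a , b) → Adj a b × a ∈ W × b ∈ W }) M
    × Unique (concatMap (λ { (a , b) → a ∷ b ∷ [] }) M)

  covered : List (Fin n × Fin n) → ℕ
  covered M = 2 * length M

module Submission where

-- Let G be an acyclic graph, P a path in G such that every vertex lies within
-- distance two of P, and W a shell of G with respect to P.  Because G has no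
-- cycles, a neighbour w ≠ p of a vertex x hanging from p ∈ P is an off-path
-- leaf.  Consequently W consists of P, the distance-one vertices that are not
-- leaves (the stems), and one kept leaf x for each stem v; the pairs (v , x)
-- are the pendant edges.  Matching consecutive vertices of P and adding all
-- pendant edges covers every vertex of W except possibly the last one of P,
-- and a parity count gives the theorem.

open import Defs
open import Data.Nat using (ℕ; suc; _+_; _*_; _≤_; z≤n; s≤s; _%_; _∸_)
open import Data.Nat.Properties using (*-comm; *-suc; +-comm; ≤-trans; 0≢1+n; 1+n≢0)
open import Data.Nat.DivMod using ([m+kn]%n≡m%n)
open import Data.Maybe using (Maybe; just; nothing)
open import Data.Vec using (here; there; _∷_)
open import Data.Fin using (Fin; zero; suc)
open import Data.Fin.Properties using (_≟_)
open import Data.Fin.Subset using (Subset; _∈_; _∉_; ∣_∣; _-_; inside; outside)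
open import Data.Fin.Subset.Properties using (_∈?_; x∈p∧x≢y⇒x∈p-y; p─q⊆p; p─⊥≡p; Empty-unique; ∣⊥∣≡0)
open import Data.List using (List; []; _∷_; length; _++_; map; mapMaybe; concatMap; reverse; allFin)
open import Data.List.Properties using (unfold-reverse; length-++-≤ʳ; length-++; ++-assoc)
open import Data.List.Membership.Propositional using () renaming (_∈_ to _∈ₗ_; _∉_ to _∉ₗ_)
open import Data.List.Membership.Propositional.Properties
  using (∉[]; ∈-map⁻; ∈-map⁺; ∈-allFin; ∈-++⁻; ∈-++⁺ˡ; ∈-++⁺ʳ)
open import Data.List.Relation.Binary.Subset.Propositional using () renaming (_⊆_ to _⊆ₗ_)
open import Data.List.Relation.Binary.Subset.Propositional.Properties using (∷⁺ʳ; xs⊆x∷xs; ⊆-trans)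
open import Data.List.Relation.Binary.Permutation.Propositional
  using (_↭_; ↭-refl; ↭-prep; ↭-sym; ↭-trans; ↭⇒↭ₛ; module PermutationReasoning)
open import Data.List.Relation.Binary.Permutation.Propositional.Properties
  using (shift; ↭-reverse; ++⁺ˡ; ++-comm; ∈-resp-↭; ↭-length)
import Data.List.Relation.Binary.Permutation.Setoid.Properties as SetoidPermutation
open import Data.List.Relation.Binary.Disjoint.Propositional using (Disjoint)
open import Data.List.Relation.Unary.Any using (here; there)
open import Data.List.Relation.Unary.Any.Properties using (reverse⁻)
open import Data.List.Relation.Unary.All as All using (All; []; _∷_)
open import Data.List.Relation.Unary.All.Properties using (¬Any⇒All¬; ++⁻ˡ)
open import Data.List.Relation.Unary.AllPairs using (AllPairs; []; _∷_)
import Data.List.Relation.Unary.AllPairs.Properties as AllPairsₚ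
open import Data.List.Relation.Unary.Linked as Linked using (Linked; []; [-]; _∷_)
open import Data.List.Relation.Unary.Unique.Propositional using (Unique)
import Data.List.Relation.Unary.Unique.Propositional.Properties as Unique
open import Data.Product using (Σ; ∃; _×_; _,_; proj₁; proj₂; map₁; map₂)
open import Data.Sum using (_⊎_; inj₁; inj₂)
open import Data.Empty using (⊥; ⊥-elim)
open import Function using (_∘_)
open import Relation.Nullary using (¬_; Dec; yes; no)
open import Relation.Binary.PropositionalEquality
  using (_≡_; _≢_; refl; sym; trans; cong; subst; setoid; module ≡-Reasoning)

flatten : {A : Set} → List (A × A) → List A
flatten = concatMap λ { (a , b) → a ∷ b ∷ [] }

flatten-++ : {A : Set} (M M' : List (A × A)) → flatten (M ++ M') ≡ flatten M ++ flatten M'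
flatten-++ []            M' = refl
flatten-++ ((a , b) ∷ M) M' = cong (λ ys → a ∷ b ∷ ys) (flatten-++ M M')

length-flatten : {A : Set} (M : List (A × A)) → length (flatten M) ≡ 2 * length M
length-flatten []      = refl
length-flatten (_ ∷ M) = trans (cong (2 +_) (length-flatten M)) (sym (*-suc 2 (length M)))

∈-flatten : {A : Set} {a b : A} (M : List (A × A)) → (a , b) ∈ₗ M → a ∈ₗ flatten M × b ∈ₗ flatten M
∈-flatten (_ ∷ M) (here refl) = here refl , there (here refl)
∈-flatten (_ ∷ M) (there m) with ∈-flatten M m
... | a∈ , b∈ = there (there a∈) , there (there b∈)

flatten-↭ : {A : Set} (M : List (A × A)) → flatten M ↭ map proj₁ M ++ map proj₂ M
flatten-↭ [] = ↭-refl
flatten-↭ ((a , b) ∷ M) = ↭-prep a (↭-trans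
  (↭-prep b (flatten-↭ M))
  (↭-sym (shift b (map proj₁ M) (map proj₂ M))))

pairUp : {A : Set} → List A → List (A × A)
pairUp []           = []
pairUp (a ∷ [])     = []
pairUp (a ∷ b ∷ xs) = (a , b) ∷ pairUp xs

unpaired : {A : Set} → List A → List A
unpaired []           = []
unpaired (a ∷ [])     = a ∷ []
unpaired (a ∷ b ∷ xs) = unpaired xs

flatten-pairUp : {A : Set} (xs : List A) → flatten (pairUp xs) ++ unpaired xs ≡ xs
flatten-pairUp []           = refl
flatten-pairUp (a ∷ [])     = refl
flatten-pairUp (a ∷ b ∷ xs) = cong (λ ys → a ∷ b ∷ ys) (flatten-pairUp xs)

unpaired-short : {A : Set} (xs : List A) → length (unpaired xs) ≤ 1
unpaired-short []           = z≤n
unpaired-short (a ∷ [])     = s≤s z≤n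
unpaired-short (a ∷ b ∷ xs) = unpaired-short xs

pairUp-linked : {A : Set} {R : A → A → Set} {xs : List A} →
  Linked R xs → All (λ e → R (proj₁ e) (proj₂ e)) (pairUp xs)
pairUp-linked []              = []
pairUp-linked [-]             = []
pairUp-linked (r ∷ [-])       = r ∷ []
pairUp-linked (r ∷ _ ∷ rs)    = r ∷ pairUp-linked rs

unique-resp-↭ : {A : Set} {xs ys : List A} → xs ↭ ys → Unique xs → Unique ys
unique-resp-↭ {A} p = SetoidPermutation.Unique-resp-↭ (setoid A) (↭⇒↭ₛ p)

unique-prefix : {A : Set} (xs : List A) {ys : List A} → Unique (xs ++ ys) → Unique xs
unique-prefix []       _          = []
unique-prefix (x ∷ xs) (x∉ ∷ u)   = ++⁻ˡ xs x∉ ∷ unique-prefix xs u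

∈-mapMaybe⁺ : {A B : Set} (f : A → Maybe B) {x : A} {y : B} (xs : List A) →
  x ∈ₗ xs → f x ≡ just y → y ∈ₗ mapMaybe f xs
∈-mapMaybe⁺ f (x ∷ xs) (here refl) fx≡y with f x | fx≡y
... | just _ | refl = here refl
∈-mapMaybe⁺ f (x ∷ xs) (there m) fx≡y with f x
... | just _  = there (∈-mapMaybe⁺ f xs m fx≡y)
... | nothing = ∈-mapMaybe⁺ f xs m fx≡y

∈-mapMaybe⁻ : {A B : Set} (f : A → Maybe B) {y : B} (xs : List A) →
  y ∈ₗ mapMaybe f xs → ∃ λ x → x ∈ₗ xs × f x ≡ just y
∈-mapMaybe⁻ f (x ∷ xs) m with f x in fx≡
... | nothing = map₂ (map₁ there) (∈-mapMaybe⁻ f xs m)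
... | just _ with m
...   | here refl = x , here refl , fx≡
...   | there m'  = map₂ (map₁ there) (∈-mapMaybe⁻ f xs m')

unique-keys : {A B : Set} (f : A → Maybe B) (key : B → A) →
  (∀ {x y} → f x ≡ just y → key y ≡ x) →
  ∀ {xs} → Unique xs → Unique (map key (mapMaybe f xs))
unique-keys f key keyed {[]}     []         = []
unique-keys f key keyed {x ∷ xs} (x∉ ∷ u) with f x in fx≡
... | nothing = unique-keys f key keyed u
... | just y  = ¬Any⇒All¬ _ key∉ ∷ unique-keys f key keyed u
  where
    key∉ : key y ∉ₗ map key (mapMaybe f xs)
    key∉ m with ∈-map⁻ key m
    ... | z , z∈ , eq with ∈-mapMaybe⁻ f xs z∈
    ...   | x' , x'∈ , fx'≡ = All.lookup x∉ x'∈ (trans (sym (keyed fx≡)) (trans eq (keyed fx'≡)))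

∣p∣≡1+∣p-x∣ : ∀ {n} (p : Subset n) {x : Fin n} → x ∈ p → ∣ p ∣ ≡ suc ∣ p - x ∣
∣p∣≡1+∣p-x∣ (inside  ∷ p) {zero}  here        = cong (suc ∘ ∣_∣) (sym (p─⊥≡p p))
∣p∣≡1+∣p-x∣ (inside  ∷ p) {suc x} (there x∈p) = cong suc (∣p∣≡1+∣p-x∣ p x∈p)
∣p∣≡1+∣p-x∣ (outside ∷ p) {suc x} (there x∈p) = ∣p∣≡1+∣p-x∣ p x∈p

x∉p-x : ∀ {n} (p : Subset n) (x : Fin n) → x ∉ p - x
x∉p-x (inside  ∷ p) zero    ()
x∉p-x (outside ∷ p) zero    ()
x∉p-x (_       ∷ p) (suc x) (there x∈p) = x∉p-x p x x∈p

length≡∣∣ : ∀ {n} (W : Subset n) (L : List (Fin n)) → Unique L →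
  (∀ {y} → y ∈ₗ L → y ∈ W) → (∀ {y} → y ∈ W → y ∈ₗ L) → length L ≡ ∣ W ∣
length≡∣∣ {n} W []       _          _     complete =
  sym (trans (cong ∣_∣ (Empty-unique (λ (_ , y∈W) → ∉[] (complete y∈W)))) (∣⊥∣≡0 n))
length≡∣∣ W (x ∷ L) (x∉L ∷ u) sound complete = begin
  suc (length L)  ≡⟨ cong suc (length≡∣∣ (W - x) L u sound⁻ complete⁻) ⟩
  suc ∣ W - x ∣   ≡⟨ sym (∣p∣≡1+∣p-x∣ W (sound (here refl))) ⟩
  ∣ W ∣           ∎
  where
    open ≡-Reasoning
    sound⁻ : ∀ {y} → y ∈ₗ L → y ∈ W - x
    sound⁻ m = x∈p∧x≢y⇒x∈p-y (sound (there m)) (λ y≡x → All.lookup x∉L m (sym y≡x))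
    complete⁻ : ∀ {y} → y ∈ W - x → y ∈ₗ L
    complete⁻ y∈ with complete (p─q⊆p W _ y∈)
    ... | here refl = ⊥-elim (x∉p-x W x y∈)
    ... | there m   = m

+2*-parity : ∀ r k → (r + 2 * k) % 2 ≡ r % 2
+2*-parity r k = trans (cong (λ t → (r + t) % 2) (*-comm 2 k)) ([m+kn]%n≡m%n r k 2)

near-perfect : ∀ {w} r k → r ≤ 1 → w ≡ r + 2 * k →
  (w % 2 ≡ 0 → 2 * k ≡ w) × (w % 2 ≡ 1 → 2 * k ≡ w ∸ 1)
near-perfect 0 k z≤n       refl =
  (λ _ → refl) , λ odd → ⊥-elim (0≢1+n (trans (sym (+2*-parity 0 k)) odd))
near-perfect 1 k (s≤s z≤n) refl =
  (λ even → ⊥-elim (1+n≢0 (trans (sym (+2*-parity 1 k)) even))) , λ _ → refl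

module Walks {n : ℕ} (G : Graph n) where
  open Graph G renaming (sym to adj-sym)

  V : Set
  V = Fin n

  open import Data.List.Membership.DecPropositional (_≟_ {n}) using () renaming (_∈?_ to _∈ₗ?_)

  adj-distinct : ∀ {a b} → Adj a b → a ≢ b
  adj-distinct ab refl = irrefl ab

  data Walk : V → V → List V → Set where
    end : ∀ {a} → Walk a a (a ∷ [])
    hop : ∀ {a b c xs} → Adj a b → Walk b c xs → Walk a c (a ∷ xs)

  walk-linked : ∀ {a b xs} → Walk a b xs → Linked Adj xs
  walk-linked end                 = [-]
  walk-linked (hop ab end)        = ab ∷ [-]
  walk-linked (hop ab (hop bc w)) = ab ∷ walk-linked (hop bc w)

  walk-last : ∀ {a b x xs} → Walk a b (x ∷ xs) → lastOf G x xs ≡ b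
  walk-last end                 = refl
  walk-last (hop _ end)         = refl
  walk-last (hop _ (hop bc w))  = walk-last (hop bc w)

  walk-++ : ∀ {a b c d xs ys} → Walk a b xs → Adj b c → Walk c d ys → Walk a d (xs ++ ys)
  walk-++ end        bc w' = hop bc w'
  walk-++ (hop ab w) bc w' = hop ab (walk-++ w bc w')

  walk-reverse : ∀ {a b xs} → Walk a b xs → Walk b a (reverse xs)
  walk-reverse end = end
  walk-reverse {a} (hop {xs = xs} ab w) =
    subst (Walk _ a) (sym (unfold-reverse a xs)) (walk-++ (walk-reverse w) (adj-sym ab) end)

  walk-length : ∀ {a b xs} → Walk a b xs → a ≢ b → 2 ≤ length xs
  walk-length end        a≢a = ⊥-elim (a≢a refl)
  walk-length (hop _ end)     _ = s≤s (s≤s z≤n)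
  walk-length (hop _ (hop _ _)) _ = s≤s (s≤s z≤n)

  no-closed-walk : ¬ HasCycle G → ∀ {a b xs} → Walk a b xs → Unique xs → Adj b a → 3 ≤ length xs → ⊥
  no-closed-walk acyclic w@(hop {xs = v ∷ u ∷ rest} ab (hop bc w')) uniq ba _ =
    acyclic (_ , v , u , rest , uniq , walk-linked w , subst (λ z → Adj z _) (sym (walk-last w')) ba)
  no-closed-walk acyclic end         _ _ (s≤s ())
  no-closed-walk acyclic (hop _ end) _ _ (s≤s (s≤s ()))

  Segment : V → V → List V → Set
  Segment a b S = Σ (List V) λ ys → Walk a b ys × Unique ys × ys ⊆ₗ S

  segment-reverse : ∀ {a b S} → Segment a b S → Segment b a S
  segment-reverse (ys , w , u , ys⊆S) =
    reverse ys , walk-reverse w , unique-resp-↭ (↭-sym (↭-reverse ys)) u , λ m → ys⊆S (reverse⁻ m)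

  segment-from-head : ∀ {x xs b} → Unique (x ∷ xs) → Linked Adj (x ∷ xs) → b ∈ₗ x ∷ xs → Segment x b (x ∷ xs)
  segment-from-head _ _ (here refl) = _ , end , [] ∷ [] , λ { (here refl) → here refl }
  segment-from-head {x} {y ∷ xs} (x∉ ∷ u) (xy ∷ l) (there m) with segment-from-head u l m
  ... | ys , w , uys , ys⊆ =
    x ∷ ys , hop xy w , ¬Any⇒All¬ ys (λ x∈ys → All.lookup x∉ (ys⊆ x∈ys) refl) ∷ uys , ∷⁺ʳ x ys⊆

  segment : ∀ {P a b} → Unique P → Linked Adj P → a ∈ₗ P → b ∈ₗ P → Segment a b P
  segment u l (here refl) b∈ = segment-from-head u l b∈
  segment u l (there a∈) (here refl) = segment-reverse (segment-from-head u l (there a∈))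
  segment {x ∷ P} (_ ∷ u) l (there a∈) (there b∈) with segment u (Linked.tail l) a∈ b∈
  ... | ys , w , uys , ys⊆ = ys , w , uys , ⊆-trans ys⊆ (xs⊆x∷xs P x)

  -- No detours around a path in an acyclic graph: a walk Q through distinct
  -- vertices off the path P, whose ends are adjacent to path vertices p and
  -- p', closes a cycle (through P between p' and p when p ≠ p'), unless Q is
  -- a single vertex and p = p'.
  no-detour : ¬ HasCycle G → ∀ {P} → Unique P → Linked Adj P →
    ∀ {c d qs p p'} → Walk c d qs → Unique qs → All (_∉ₗ P) qs →
    p ∈ₗ P → p' ∈ₗ P → Adj p c → Adj d p' → 2 ≤ length qs ⊎ p ≢ p' → ⊥
  no-detour acyclic {P} uP lP {qs = qs} {p} {p'} Q uQ Q∉P p∈P p'∈P pc dp' long-or-apart with p ≟ p'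
  ... | yes refl = no-closed-walk acyclic (hop pc Q) (p∉Q ∷ uQ) dp' (long long-or-apart)
    where
      p∉Q : All (p ≢_) qs
      p∉Q = All.map (λ z∉P p≡z → z∉P (subst (_∈ₗ P) p≡z p∈P)) Q∉P
      long : 2 ≤ length qs ⊎ p ≢ p → 3 ≤ suc (length qs)
      long (inj₁ two≤) = s≤s two≤
      long (inj₂ p≢p)  = ⊥-elim (p≢p refl)
  ... | no p≢p' with segment uP lP p'∈P p∈P
  ...   | ys , S , uS , S⊆P =
    no-closed-walk acyclic (walk-++ Q dp' S)
      (Unique.++⁺ uQ uS (λ (z∈Q , z∈S) → All.lookup Q∉P z∈Q (S⊆P z∈S))) pc (long Q)
    where
      long : ∀ {c d qs} → Walk c d qs → 3 ≤ length (qs ++ ys)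
      long {qs = _ ∷ qs'} _ =
        s≤s (≤-trans (walk-length S (λ p'≡p → p≢p' (sym p'≡p))) (length-++-≤ʳ ys {qs'}))

  leaf-nbr-unique : ∀ {u a b} → Leaf G u → Adj u a → Adj u b → a ≡ b
  leaf-nbr-unique (c , _ , only-c) ua ub = trans (only-c _ ua) (sym (only-c _ ub))

  leaf-nbr-not-dist1 : ∀ {P v u} → LeafNbrOffP G P v u → v ∉ₗ P → ¬ Dist1 G P u
  leaf-nbr-not-dist1 {P} (vu , u-leaf , _) v∉P (_ , p , p∈P , pu) =
    v∉P (subst (_∈ₗ P) (leaf-nbr-unique u-leaf (adj-sym pu) (adj-sym vu)) p∈P)

  module Lobster (acyclic : ¬ HasCycle G) {P : List V} (uP : Unique P) (lP : Linked Adj P)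
                 (within2 : ∀ v → Within2 G P v) where

    second-layer-off-path : ∀ {p x w} → p ∈ₗ P → x ∉ₗ P → Adj p x → Adj x w → w ≢ p → w ∉ₗ P
    second-layer-off-path p∈P x∉P px xw w≢p w∈P =
      no-detour acyclic uP lP end ([] ∷ []) (x∉P ∷ []) p∈P w∈P px xw (inj₂ λ p≡w → w≢p (sym p≡w))

    -- ... and there is no third step: another neighbour y of w would lie at
    -- distance three from P, or close a cycle with P.
    no-third-layer : ∀ {p x w y} → p ∈ₗ P → x ∉ₗ P → w ∉ₗ P →
      Adj p x → Adj x w → Adj w y → y ≢ x → ⊥
    no-third-layer {p} {x} {w} {y} p∈P x∉P w∉P px xw wy y≢x = beyond (y ∈ₗ? P) (within2 y)
      where
        x≢w : x ≢ w
        x≢w = adj-distinct xw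
        w≢y : w ≢ y
        w≢y = adj-distinct wy
        x≢y : x ≢ y
        x≢y x≡y = y≢x (sym x≡y)
        two-steps : ∀ {q} → q ∈ₗ P → Adj w q → ⊥
        two-steps q∈P wq = no-detour acyclic uP lP (hop xw end) ((x≢w ∷ []) ∷ [] ∷ [])
          (x∉P ∷ w∉P ∷ []) p∈P q∈P px wq (inj₁ (s≤s (s≤s z≤n)))
        three-steps : ∀ {q} → y ∉ₗ P → q ∈ₗ P → Adj y q → ⊥
        three-steps y∉P q∈P yq = no-detour acyclic uP lP (hop xw (hop wy end))
          ((x≢w ∷ x≢y ∷ []) ∷ (w≢y ∷ []) ∷ [] ∷ [])
          (x∉P ∷ w∉P ∷ y∉P ∷ []) p∈P q∈P px yq (inj₁ (s≤s (s≤s z≤n)))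
        -- y on P or adjacent to P gives the detour x w or x w y; if y reaches P
        -- through z, then z = x closes the triangle x w y, z = w gives the
        -- detour x w, and otherwise x w y z is a detour.
        beyond : Dec (y ∈ₗ P) → Within2 G P y → ⊥
        beyond (yes y∈P) _ = two-steps y∈P wy
        beyond (no y∉P) (inj₁ y∈P) = y∉P y∈P
        beyond (no y∉P) (inj₂ (inj₁ (q , q∈P , qy))) = three-steps y∉P q∈P (adj-sym qy)
        beyond (no y∉P) (inj₂ (inj₂ (z , (q , q∈P , qz) , zy))) with z ∈ₗ? P | z ≟ x | z ≟ w
        ... | yes z∈P | _        | _        = three-steps y∉P z∈P (adj-sym zy)
        ... | no _    | yes refl | _        = no-closed-walk acyclic (hop xw (hop wy end))
          ((x≢w ∷ x≢y ∷ []) ∷ (w≢y ∷ []) ∷ [] ∷ []) (adj-sym zy) (s≤s (s≤s (s≤s z≤n)))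
        ... | no _    | no _     | yes refl = two-steps q∈P (adj-sym qz)
        ... | no z∉P  | no z≢x   | no z≢w   = no-detour acyclic uP lP
          (hop xw (hop wy (hop (adj-sym zy) end)))
          ((x≢w ∷ x≢y ∷ (λ x≡z → z≢x (sym x≡z)) ∷ []) ∷ (w≢y ∷ (λ w≡z → z≢w (sym w≡z)) ∷ [])
            ∷ ((λ y≡z → adj-distinct zy (sym y≡z)) ∷ []) ∷ [] ∷ [])
          (x∉P ∷ w∉P ∷ y∉P ∷ z∉P ∷ []) p∈P q∈P px (adj-sym qz) (inj₁ (s≤s (s≤s z≤n)))

    beyond-first-layer : ∀ {p x w} → p ∈ₗ P → x ∉ₗ P → Adj p x → Adj x w → w ≢ p → w ∉ₗ P × Leaf G w
    beyond-first-layer {x = x} {w} p∈P x∉P px xw w≢p = w∉P , x , adj-sym xw , only-x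
      where
        w∉P : w ∉ₗ P
        w∉P = second-layer-off-path p∈P x∉P px xw w≢p
        only-x : ∀ y → Adj w y → y ≡ x
        only-x y wy with y ≟ x
        ... | yes y≡x = y≡x
        ... | no y≢x  = ⊥-elim (no-third-layer p∈P x∉P w∉P px xw wy y≢x)

    module Shell (W : Subset n) (shell : IsShell G P W) where

      path-kept : ∀ v → v ∈ₗ P → v ∈ W
      path-kept = proj₁ shell

      leaf-dropped : ∀ v → Dist1 G P v → Leaf G v → v ∉ W
      leaf-dropped = proj₁ (proj₂ shell)

      stem-kept : ∀ v → Dist1 G P v → ¬ Leaf G v → v ∈ W
      stem-kept = proj₁ (proj₂ (proj₂ shell))

      one-leaf-kept : ∀ v → Dist1 G P v → (Σ V λ u → LeafNbrOffP G P v u) →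
        Σ V λ u → LeafNbrOffP G P v u × u ∈ W × (∀ u' → LeafNbrOffP G P v u' → u' ∈ W → u' ≡ u)
      one-leaf-kept = proj₁ (proj₂ (proj₂ (proj₂ shell)))

      ShellCase : V → Set
      ShellCase w = w ∈ₗ P ⊎ Dist1 G P w ⊎ (Σ V λ v → Dist1 G P v × LeafNbrOffP G P v w)

      shell-cases : ∀ w → w ∈ W → ShellCase w
      shell-cases = proj₂ (proj₂ (proj₂ (proj₂ shell)))

      record Pendant (v x : V) : Set where
        field
          leaf∈W   : x ∈ W
          stem-d1  : Dist1 G P v
          leaf-nbr : LeafNbrOffP G P v x

      -- The stem of a pendant edge stays in the shell: it has two distinct
      -- neighbours, one on P and the leaf off P, so it is no leaf itself.
      stem∈W : ∀ {v x} → Pendant v x → v ∈ W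
      stem∈W {v} {x} e = stem-kept v stem-d1 not-leaf
        where
          open Pendant e
          not-leaf : ¬ Leaf G v
          not-leaf v-leaf with stem-d1 | leaf-nbr
          ... | _ , p , p∈P , pv | vx , _ , x∉P =
            x∉P (subst (_∈ₗ P) (leaf-nbr-unique v-leaf (adj-sym pv) vx) p∈P)

      same-stem-same-leaf : ∀ {v x x'} → Pendant v x → Pendant v x' → x ≡ x'
      same-stem-same-leaf {v} {x} {x'} e e' with one-leaf-kept v (Pendant.stem-d1 e) (x , Pendant.leaf-nbr e)
      ... | _ , _ , _ , only =
        trans (only x (Pendant.leaf-nbr e) (Pendant.leaf∈W e)) (sym (only x' (Pendant.leaf-nbr e') (Pendant.leaf∈W e')))

      -- A kept leaf is never a stem: stems are adjacent to P, kept leaves are not.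
      leaf≢stem : ∀ {v x v' x'} → Pendant v x → Pendant v' x' → x ≢ v'
      leaf≢stem e e' refl =
        leaf-nbr-not-dist1 (Pendant.leaf-nbr e) (proj₁ (Pendant.stem-d1 e)) (Pendant.stem-d1 e')

      pendantOf : (x : V) → ShellCase x → Maybe (V × V)
      pendantOf x (inj₂ (inj₂ (v , _))) = just (v , x)
      pendantOf x _                     = nothing

      pendantIf : (x : V) → Dec (x ∈ W) → Maybe (V × V)
      pendantIf x (yes x∈W) = pendantOf x (shell-cases x x∈W)
      pendantIf x (no _)    = nothing

      pendantAt : V → Maybe (V × V)
      pendantAt x = pendantIf x (x ∈? W)

      pendantAt-sound : ∀ x {e} → pendantAt x ≡ just e → Pendant (proj₁ e) (proj₂ e) × proj₂ e ≡ x
      pendantAt-sound x with x ∈? W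
      ... | yes x∈W = sound (shell-cases x x∈W)
        where
          sound : (k : ShellCase x) → ∀ {e} → pendantOf x k ≡ just e → Pendant (proj₁ e) (proj₂ e) × proj₂ e ≡ x
          sound (inj₂ (inj₂ (v , d , l))) refl = record { leaf∈W = x∈W ; stem-d1 = d ; leaf-nbr = l } , refl
          sound (inj₁ _)                  ()
          sound (inj₂ (inj₁ _))           ()
      ... | no _    = λ ()

      pendantAt-complete : ∀ {x} → x ∈ W → x ∉ₗ P → ¬ Dist1 G P x → Σ V λ v → pendantAt x ≡ just (v , x)
      pendantAt-complete {x} x∈W x∉P ¬d1 with x ∈? W
      ... | no x∉W  = ⊥-elim (x∉W x∈W)
      ... | yes x∈W′ with shell-cases x x∈W′
      ...   | inj₁ x∈P              = ⊥-elim (x∉P x∈P)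
      ...   | inj₂ (inj₁ d1)        = ⊥-elim (¬d1 d1)
      ...   | inj₂ (inj₂ (v , _))   = v , refl

      edges : List (V × V)
      edges = mapMaybe pendantAt (allFin n)

      stems leaves : List V
      stems  = map proj₁ edges
      leaves = map proj₂ edges

      edge-pendant : ∀ {e} → e ∈ₗ edges → Pendant (proj₁ e) (proj₂ e)
      edge-pendant m with ∈-mapMaybe⁻ pendantAt (allFin n) m
      ... | x , _ , eq = proj₁ (pendantAt-sound x eq)

      edge-of-leaf : ∀ {x} → x ∈ W → x ∉ₗ P → ¬ Dist1 G P x → Σ V λ v → (v , x) ∈ₗ edges
      edge-of-leaf {x} x∈W x∉P ¬d1 with pendantAt-complete x∈W x∉P ¬d1
      ... | v , eq = v , ∈-mapMaybe⁺ pendantAt (allFin n) (∈-allFin x) eq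

      -- Leaves are distinct by construction (each comes from its own vertex),
      -- hence so are stems, and no stem is a leaf.
      leaves-unique : Unique leaves
      leaves-unique = unique-keys pendantAt proj₂ (λ eq → proj₂ (pendantAt-sound _ eq)) (Unique.allFin⁺ n)

      stems-unique : Unique stems
      stems-unique = AllPairsₚ.map⁺ (distinct (All.tabulate edge-pendant) (AllPairsₚ.map⁻ leaves-unique))
        where
          distinct : ∀ {es} → All (λ e → Pendant (proj₁ e) (proj₂ e)) es →
            AllPairs (λ e e' → proj₂ e ≢ proj₂ e') es → AllPairs (λ e e' → proj₁ e ≢ proj₁ e') es
          distinct []         []         = []
          distinct {e ∷ _} (pe ∷ pes) (d ∷ ds) = All.zipWith stems-differ (d , pes) ∷ distinct pes ds
            where
              stems-differ : ∀ {e'} → proj₂ e ≢ proj₂ e' × Pendant (proj₁ e') (proj₂ e') → proj₁ e ≢ proj₁ e'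
              stems-differ (x≢x' , pe') v≡v' =
                x≢x' (same-stem-same-leaf pe (subst (λ v → Pendant v _) (sym v≡v') pe'))

      stems-leaves-disjoint : Disjoint stems leaves
      stems-leaves-disjoint (v∈stems , v∈leaves) with ∈-map⁻ proj₁ v∈stems | ∈-map⁻ proj₂ v∈leaves
      ... | e , e∈ , refl | e' , e'∈ , eq = leaf≢stem (edge-pendant e'∈) (edge-pendant e∈) (sym eq)

      pendant-vertex : ∀ {v} → v ∈ₗ stems ++ leaves → v ∈ W × v ∉ₗ P
      pendant-vertex m with ∈-++⁻ stems m
      ... | inj₁ v∈stems with ∈-map⁻ proj₁ v∈stems
      ...   | e , e∈ , refl = stem∈W (edge-pendant e∈) , proj₁ (Pendant.stem-d1 (edge-pendant e∈))
      pendant-vertex m | inj₂ v∈leaves with ∈-map⁻ proj₂ v∈leaves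
      ...   | e , e∈ , refl = Pendant.leaf∈W (edge-pendant e∈) , proj₂ (proj₂ (Pendant.leaf-nbr (edge-pendant e∈)))

      -- A distance-one vertex w with a neighbour besides its path neighbour p
      -- carries off-path leaves (by `beyond-first-layer`), so one of them is
      -- kept and w is the stem of its pendant edge.
      branching-is-stem : ∀ {p w y} → p ∈ₗ P → w ∉ₗ P → Adj p w → Adj w y → y ≢ p → w ∈ₗ stems
      branching-is-stem {p} {w} {y} p∈P w∉P pw wy y≢p with beyond-first-layer p∈P w∉P pw wy y≢p
      ... | y∉P , y-leaf with one-leaf-kept w (w∉P , p , p∈P , pw) (y , wy , y-leaf , y∉P)
      ... | u , l@(wu , u-leaf , u∉P) , u∈W , _ with edge-of-leaf u∈W u∉P (leaf-nbr-not-dist1 l w∉P)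
      ... | v , vu∈ = subst (_∈ₗ stems) v≡w (∈-map⁺ proj₁ vu∈)
        where
          v≡w : v ≡ w
          v≡w = leaf-nbr-unique u-leaf (adj-sym (proj₁ (Pendant.leaf-nbr (edge-pendant vu∈)))) (adj-sym wu)

      -- Every distance-one vertex of the shell is a stem: otherwise all its
      -- neighbours equal its path neighbour, making it a leaf, and such leaves
      -- were deleted.
      dist1-is-stem : ∀ {w} → Dist1 G P w → w ∈ W → w ∈ₗ stems
      dist1-is-stem {w} d1@(w∉P , p , p∈P , pw) w∈W with w ∈ₗ? stems
      ... | yes w∈stems = w∈stems
      ... | no w∉stems  = ⊥-elim (leaf-dropped w d1 (p , adj-sym pw , only-p) w∈W)
        where
          only-p : ∀ y → Adj w y → y ≡ p
          only-p y wy with y ≟ p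
          ... | yes y≡p = y≡p
          ... | no y≢p  = ⊥-elim (w∉stems (branching-is-stem p∈P w∉P pw wy y≢p))

      enumeration : List V
      enumeration = P ++ (stems ++ leaves)

      enumeration-unique : Unique enumeration
      enumeration-unique =
        Unique.++⁺ uP (Unique.++⁺ stems-unique leaves-unique stems-leaves-disjoint)
          (λ (v∈P , v∈) → proj₂ (pendant-vertex v∈) v∈P)

      enumeration⊆W : ∀ {v} → v ∈ₗ enumeration → v ∈ W
      enumeration⊆W m with ∈-++⁻ P m
      ... | inj₁ v∈P = path-kept _ v∈P
      ... | inj₂ v∈  = proj₁ (pendant-vertex v∈)

      W⊆enumeration : ∀ {w} → w ∈ W → w ∈ₗ enumeration
      W⊆enumeration {w} w∈W with shell-cases w w∈W
      ... | inj₁ w∈P = ∈-++⁺ˡ w∈P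
      ... | inj₂ (inj₁ d1) = ∈-++⁺ʳ P (∈-++⁺ˡ (dist1-is-stem d1 w∈W))
      ... | inj₂ (inj₂ (v , (v∉P , _) , l@(_ , _ , w∉P))) =
        ∈-++⁺ʳ P (∈-++⁺ʳ stems (∈-map⁺ proj₂ (proj₂ (edge-of-leaf w∈W w∉P (leaf-nbr-not-dist1 l v∉P)))))

      matching : List (V × V)
      matching = pairUp P ++ edges

      arrangement : flatten matching ++ unpaired P ↭ enumeration
      arrangement = begin
        flatten (pairUp P ++ edges) ++ unpaired P
          ≡⟨ cong (_++ unpaired P) (flatten-++ (pairUp P) edges) ⟩
        (flatten (pairUp P) ++ flatten edges) ++ unpaired P
          ≡⟨ ++-assoc (flatten (pairUp P)) (flatten edges) (unpaired P) ⟩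
        flatten (pairUp P) ++ (flatten edges ++ unpaired P)
          ↭⟨ ++⁺ˡ (flatten (pairUp P)) (++-comm (flatten edges) (unpaired P)) ⟩
        flatten (pairUp P) ++ (unpaired P ++ flatten edges)
          ≡⟨ ++-assoc (flatten (pairUp P)) (unpaired P) (flatten edges) ⟨
        (flatten (pairUp P) ++ unpaired P) ++ flatten edges
          ≡⟨ cong (_++ flatten edges) (flatten-pairUp P) ⟩
        P ++ flatten edges
          ↭⟨ ++⁺ˡ P (flatten-↭ edges) ⟩
        P ++ (stems ++ leaves) ∎
        where open PermutationReasoning

      matching-edge : ∀ {e} → e ∈ₗ matching → Adj (proj₁ e) (proj₂ e)
      matching-edge m with ∈-++⁻ (pairUp P) m
      ... | inj₁ e∈pairs = All.lookup (pairUp-linked lP) e∈pairs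
      ... | inj₂ e∈edges = proj₁ (Pendant.leaf-nbr (edge-pendant e∈edges))

      matched∈W : ∀ {v} → v ∈ₗ flatten matching → v ∈ W
      matched∈W m = enumeration⊆W (∈-resp-↭ arrangement (∈-++⁺ˡ m))

      -- Every pair of the matching is an edge of the shell, and its vertices are
      -- distinct because they form a prefix of a rearranged enumeration.
      matching-valid : IsMatchingIn G W matching
      matching-valid =
          All.tabulate (λ m → matching-edge m , matched∈W (proj₁ (∈-flatten matching m))
                                             , matched∈W (proj₂ (∈-flatten matching m)))
        , unique-prefix (flatten matching) (unique-resp-↭ (↭-sym arrangement) enumeration-unique)

      shell-size : ∣ W ∣ ≡ length (unpaired P) + 2 * length matching
      shell-size = begin
        ∣ W ∣
          ≡⟨ length≡∣∣ W enumeration enumeration-unique enumeration⊆W W⊆enumeration ⟨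
        length enumeration
          ≡⟨ ↭-length arrangement ⟨
        length (flatten matching ++ unpaired P)
          ≡⟨ length-++ (flatten matching) ⟩
        length (flatten matching) + length (unpaired P)
          ≡⟨ +-comm (length (flatten matching)) _ ⟩
        length (unpaired P) + length (flatten matching)
          ≡⟨ cong (length (unpaired P) +_) (length-flatten matching) ⟩
        length (unpaired P) + 2 * length matching ∎
        where open ≡-Reasoning

mainTheorem3 : (N : ℕ) (T : Graph N) → IsTree T →
    (P : List (Fin N)) → IsLongestPath T P → (∀ v → Within2 T P v) →
    (W : Subset N) → IsShell T P W →
      (∣ W ∣ % 2 ≡ 0 → Σ (List (Fin N × Fin N)) λ M → IsMatchingIn T W M × covered T M ≡ ∣ W ∣)
    × (∣ W ∣ % 2 ≡ 1 → Σ (List (Fin N × Fin N)) λ M → IsMatchingIn T W M × covered T M ≡ ∣ W ∣ ∸ 1)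
mainTheorem3 N T (_ , acyclic) P ((uP , lP , _) , _) within2 W shell =
  let (perfect , near) = near-perfect (length (unpaired P)) (length matching) (unpaired-short P) shell-size
  in  (λ even → matching , matching-valid , perfect even)
    , (λ odd  → matching , matching-valid , near odd)
  where open Walks.Lobster.Shell T acyclic uP lP within2 W shell
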